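{- Let $\ell_1,\ell_2$ be binary $\mathbb{Z}$-lattices. If there is a positive integer $a$ with $a^2\le 4\, d\ell_1\, d\ell_2$ that is primitively represented by both $\ell_1$ and $\ell_2$, then the pair $(\ell_1,\ell_2)$ is buried in rank $3$.
   Context: A $\mathbb{Z}$-lattice means a free $\mathbb{Z}$-module of finite rank with a positive definite integer-valued symmetric bilinear form $B$; $d\ell$ is the determinant of its Gram matrix. Representation means existence of an isometric linear map; $a$ is primitively represented by $\ell$ if $a=B(x,x)$ for a primitive vector $x\in\ell$. The pair $(\ell_1,\ell_2)$ is buried in rank $3$ if some $\mathbb{Z}$-lattice of rank $3$ represents both $\ell_1$ and $\ell_2$. -}

module Defs where

open import Data.Nat using (ℕ; zero; suc)
open import Data.Fin using (Fin; zero; suc)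
open import Data.Integer using (ℤ; +_; _+_; _*_; _-_; _<_)
open import Data.Integer.Divisibility using (_∣_)
open import Data.Product using (Σ; ∃; _×_)
open import Relation.Binary.PropositionalEquality using (_≡_; _≢_)

Vecℤ : ℕ → Set
Vecℤ n = Fin n → ℤ

Σℤ : (n : ℕ) → (Fin n → ℤ) → ℤ
Σℤ zero    f = + 0
Σℤ (suc n) f = f zero + Σℤ n (λ i → f (suc i))

bilin : {n : ℕ} → (Fin n → Fin n → ℤ) → Vecℤ n → Vecℤ n → ℤ
bilin {n} G x y = Σℤ n (λ i → Σℤ n (λ j → x i * G i j * y j))

NonZeroVec : {n : ℕ} → Vecℤ n → Set
NonZeroVec {n} x = Σ (Fin n) (λ i → x i ≢ + 0)

-- a ℤ-lattice of rank n, given by a basis: a symmetric, positive definite,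
-- integer-valued Gram matrix
record ZLattice (n : ℕ) : Set where
  field
    gram    : Fin n → Fin n → ℤ
    symm    : ∀ i j → gram i j ≡ gram j i
    posdef  : (x : Vecℤ n) → NonZeroVec x → + 0 < bilin gram x x

open ZLattice public

B : {n : ℕ} → ZLattice n → Vecℤ n → Vecℤ n → ℤ
B L = bilin (gram L)

-- L represents ℓ : there is a linear map ℓ → L (given by the images T i of
-- the basis vectors of ℓ) preserving the bilinear form
Represents : {n m : ℕ} → ZLattice n → ZLattice m → Set
Represents {n} {m} L ℓ =
  Σ (Fin m → Vecℤ n) (λ T → ∀ i j → B L (T i) (T j) ≡ gram ℓ i j)

Primitive : {n : ℕ} → Vecℤ n → Set
Primitive {n} x = ∀ (d : ℤ) → (∀ i → d ∣ x i) → d ∣ + 1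

PrimRepresents : {n : ℕ} → ZLattice n → ℤ → Set
PrimRepresents {n} L a = Σ (Vecℤ n) (λ x → Primitive x × B L x x ≡ a)

det2 : ZLattice 2 → ℤ
det2 ℓ = gram ℓ zero zero * gram ℓ (suc zero) (suc zero)
       - gram ℓ zero (suc zero) * gram ℓ (suc zero) zero

BuriedInRank3 : {n m : ℕ} → ZLattice n → ZLattice m → Set
BuriedInRank3 ℓ₁ ℓ₂ = Σ (ZLattice 3) (λ L → Represents L ℓ₁ × Represents L ℓ₂)

module Submission where

-- Written in a basis whose first vector is a primitive vector of norm a, ℓᵢ has Gram matrix
-- [[a, bᵢ], [bᵢ, cᵢ]] with dᵢ = a cᵢ − bᵢ² = det ℓᵢ. Gluing the two along that common vector gives the
-- ternary form Q = [[a, b₁, b₂], [b₁, c₁, t], [b₂, t, c₂]], where t is chosen so that s = a t − b₁ b₂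
-- satisfies 4 s² ≤ a². Lagrange's reduction a d₁ Q(v) = d₁ L(v)² + M(v)² + Δ v₂², with
-- Δ = d₁ d₂ − s² = a · det Q, and the hypothesis a² ≤ 4 d₁ d₂ show Q ≥ 0. If Δ > 0, Q is itself a ternary
-- lattice. If Δ = 0, the radical of Q is spanned by a primitive vector k; for w with w · k = 1 the form
-- Q + w wᵀ is positive definite and u ↦ u − (w · u) k embeds Q isometrically into it.

open import Defs
open import Data.Fin using (Fin; zero; suc)
open import Data.Fin.Patterns using (0F; 1F; 2F)
open import Data.Integer
  using (ℤ; +_; -[1+_]; +[1+_]; _+_; _-_; -_; _*_; ∣_∣; _≤_; _<_; +≤+; +<+; _≟_; ≢-nonZero)
import Data.Integer.Properties as ℤP
open import Data.Integer.Divisibility using (_∣_)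
import Data.Integer.Divisibility.Signed as Signed
open import Data.Integer.DivMod using (_%ℕ_; _/ℕ_; a≡a%ℕn+[a/ℕn]*n; n%ℕd<d)
open import Data.Integer.Tactic.RingSolver using (solve-∀)
open import Data.Nat as ℕ using (ℕ; zero; suc; z≤n; s≤s)
import Data.Nat.Properties as ℕP
import Data.Nat.Divisibility as ℕDiv
open import Data.Nat.GCD using (module Bézout; module GCD)
open import Data.Product using (Σ; ∃-syntax; _×_; _,_; proj₁; proj₂)
open import Data.Sum using (_⊎_; inj₁; inj₂; [_,_]′)
open import Function using (_∘_)
open import Relation.Nullary using (¬_; Dec; yes; no; contradiction)
open import Relation.Binary.PropositionalEquality

*-nonneg : ∀ {x y} → + 0 ≤ x → + 0 ≤ y → + 0 ≤ x * y
*-nonneg {+ m} {+ n} _ _ = subst (+ 0 ≤_) (ℤP.pos-* m n) (+≤+ z≤n)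

0<1 : + 0 < + 1
0<1 = +<+ (s≤s z≤n)

square-nonneg : ∀ x → + 0 ≤ x * x
square-nonneg (+ n)    = *-nonneg {+ n} {+ n} (+≤+ z≤n) (+≤+ z≤n)
square-nonneg -[1+ n ] = +≤+ z≤n

square-pos : ∀ {x} → x ≢ + 0 → + 0 < x * x
square-pos {+ zero}   x≢0 = contradiction refl x≢0
square-pos {+[1+ n ]} _   = +<+ (s≤s z≤n)
square-pos { -[1+ n ]} _  = +<+ (s≤s z≤n)

*-pos : ∀ {x y} → + 0 < x → + 0 < y → + 0 < x * y
*-pos {+[1+ m ]} {+[1+ n ]} (+<+ _) (+<+ _) = +<+ (s≤s z≤n)

pos-*-cancel : ∀ {k x} → + 0 < k → + 0 < k * x → + 0 < x
pos-*-cancel {+[1+ k ]} {x} (+<+ _) 0<kx =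
  ℤP.*-cancelˡ-<-nonNeg +[1+ k ] (subst (_< +[1+ k ] * x) (sym (ℤP.*-zeroʳ +[1+ k ])) 0<kx)

sum-pos : ∀ {x y z} → + 0 ≤ x → + 0 ≤ y → + 0 ≤ z →
          + 0 < x ⊎ + 0 < y ⊎ + 0 < z → + 0 < x + y + z
sum-pos 0≤x 0≤y 0≤z (inj₁ 0<x)        = ℤP.+-mono-<-≤ (ℤP.+-mono-<-≤ 0<x 0≤y) 0≤z
sum-pos 0≤x 0≤y 0≤z (inj₂ (inj₁ 0<y)) = ℤP.+-mono-<-≤ (ℤP.+-mono-≤-< 0≤x 0<y) 0≤z
sum-pos 0≤x 0≤y 0≤z (inj₂ (inj₂ 0<z)) = ℤP.+-mono-≤-< (ℤP.+-mono-≤ 0≤x 0≤y) 0<z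

vec2 : ℤ → ℤ → Vecℤ 2
vec2 x₀ x₁ 0F = x₀
vec2 x₀ x₁ 1F = x₁

vec3 : ℤ → ℤ → ℤ → Vecℤ 3
vec3 x₀ x₁ x₂ 0F = x₀
vec3 x₀ x₁ x₂ 1F = x₁
vec3 x₀ x₁ x₂ 2F = x₂

dot : Vecℤ 3 → Vecℤ 3 → ℤ
dot x y = x 0F * y 0F + x 1F * y 1F + x 2F * y 2F

cross : Vecℤ 3 → Vecℤ 3 → Vecℤ 3
cross x y = vec3 (x 1F * y 2F - x 2F * y 1F) (x 2F * y 0F - x 0F * y 2F) (x 0F * y 1F - x 1F * y 0F)

det3 : Vecℤ 3 → Vecℤ 3 → Vecℤ 3 → ℤ
det3 x y z = dot z (cross x y)

dot-self-pos : ∀ {v} → NonZeroVec v → + 0 < dot v v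
dot-self-pos {v} (i , vᵢ≢0) =
  sum-pos (square-nonneg (v 0F)) (square-nonneg (v 1F)) (square-nonneg (v 2F)) (nonzero-square i vᵢ≢0)
  where
  nonzero-square : ∀ i → v i ≢ + 0 → + 0 < v 0F * v 0F ⊎ + 0 < v 1F * v 1F ⊎ + 0 < v 2F * v 2F
  nonzero-square 0F v₀≢0 = inj₁ (square-pos v₀≢0)
  nonzero-square 1F v₁≢0 = inj₂ (inj₁ (square-pos v₁≢0))
  nonzero-square 2F v₂≢0 = inj₂ (inj₂ (square-pos v₂≢0))

cramer-identity : ∀ ρ₁ ρ₂ ρ₃ v → det3 ρ₁ ρ₂ ρ₃ * dot v v
  ≡ dot ρ₁ v * det3 v ρ₂ ρ₃ + dot ρ₂ v * det3 ρ₁ v ρ₃ + dot ρ₃ v * det3 ρ₁ ρ₂ v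
cramer-identity ρ₁ ρ₂ ρ₃ v = polynomial
  (ρ₁ 0F) (ρ₁ 1F) (ρ₁ 2F) (ρ₂ 0F) (ρ₂ 1F) (ρ₂ 2F) (ρ₃ 0F) (ρ₃ 1F) (ρ₃ 2F) (v 0F) (v 1F) (v 2F)
  where
  polynomial : ∀ x₀ x₁ x₂ y₀ y₁ y₂ z₀ z₁ z₂ v₀ v₁ v₂ →
    let dot′ a₀ a₁ a₂ b₀ b₁ b₂ = a₀ * b₀ + a₁ * b₁ + a₂ * b₂
        det′ a₀ a₁ a₂ b₀ b₁ b₂ c₀ c₁ c₂ =
          dot′ c₀ c₁ c₂ (a₁ * b₂ - a₂ * b₁) (a₂ * b₀ - a₀ * b₂) (a₀ * b₁ - a₁ * b₀)
    in det′ x₀ x₁ x₂ y₀ y₁ y₂ z₀ z₁ z₂ * dot′ v₀ v₁ v₂ v₀ v₁ v₂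
       ≡ dot′ x₀ x₁ x₂ v₀ v₁ v₂ * det′ v₀ v₁ v₂ y₀ y₁ y₂ z₀ z₁ z₂
         + dot′ y₀ y₁ y₂ v₀ v₁ v₂ * det′ x₀ x₁ x₂ v₀ v₁ v₂ z₀ z₁ z₂
         + dot′ z₀ z₁ z₂ v₀ v₁ v₂ * det′ x₀ x₁ x₂ y₀ y₁ y₂ v₀ v₁ v₂
  polynomial = solve-∀

orthogonal-to-independent⇒zero : ∀ ρ₁ ρ₂ ρ₃ {v} → det3 ρ₁ ρ₂ ρ₃ ≢ + 0 →
  dot ρ₁ v ≡ + 0 → dot ρ₂ v ≡ + 0 → dot ρ₃ v ≡ + 0 → ¬ NonZeroVec v
orthogonal-to-independent⇒zero ρ₁ ρ₂ ρ₃ {v} det≢0 ρ₁v≡0 ρ₂v≡0 ρ₃v≡0 v≢0 =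
  [ det≢0 , (λ vv≡0 → ℤP.<⇒≢ (dot-self-pos v≢0) (sym vv≡0)) ]′
    (ℤP.i*j≡0⇒i≡0∨j≡0 (det3 ρ₁ ρ₂ ρ₃) det*vv≡0)
  where
  det*vv≡0 : det3 ρ₁ ρ₂ ρ₃ * dot v v ≡ + 0
  det*vv≡0 = trans (cramer-identity ρ₁ ρ₂ ρ₃ v)
    (cong₂ _+_ (cong₂ _+_ (cong (_* det3 v ρ₂ ρ₃) ρ₁v≡0) (cong (_* det3 ρ₁ v ρ₃) ρ₂v≡0))
               (cong (_* det3 ρ₁ ρ₂ v) ρ₃v≡0))

positive-of-squares : ∀ {K c₁ c₂ c₃ q} ρ₁ ρ₂ ρ₃ {v} →
  + 0 < K → + 0 < c₁ → + 0 < c₂ → + 0 < c₃ → det3 ρ₁ ρ₂ ρ₃ ≢ + 0 → NonZeroVec v →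
  c₁ * (dot ρ₁ v * dot ρ₁ v) + c₂ * (dot ρ₂ v * dot ρ₂ v) + c₃ * (dot ρ₃ v * dot ρ₃ v) ≤ K * q →
  + 0 < q
positive-of-squares {c₁ = c₁} {c₂} {c₃} ρ₁ ρ₂ ρ₃ {v} 0<K 0<c₁ 0<c₂ 0<c₃ det≢0 v≢0 squares≤Kq =
  pos-*-cancel 0<K (ℤP.<-≤-trans
    (sum-pos (term-nonneg 0<c₁ (dot ρ₁ v)) (term-nonneg 0<c₂ (dot ρ₂ v)) (term-nonneg 0<c₃ (dot ρ₃ v))
             some-term-pos)
    squares≤Kq)
  where
  term-nonneg : ∀ {c} → + 0 < c → ∀ x → + 0 ≤ c * (x * x)
  term-nonneg 0<c x = *-nonneg (ℤP.<⇒≤ 0<c) (square-nonneg x)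
  some-term-pos : + 0 < c₁ * (dot ρ₁ v * dot ρ₁ v) ⊎ + 0 < c₂ * (dot ρ₂ v * dot ρ₂ v)
                  ⊎ + 0 < c₃ * (dot ρ₃ v * dot ρ₃ v)
  some-term-pos with dot ρ₁ v ≟ + 0 | dot ρ₂ v ≟ + 0 | dot ρ₃ v ≟ + 0
  ... | no ρ₁v≢0 | _        | _        = inj₁ (*-pos 0<c₁ (square-pos ρ₁v≢0))
  ... | yes _    | no ρ₂v≢0 | _        = inj₂ (inj₁ (*-pos 0<c₂ (square-pos ρ₂v≢0)))
  ... | yes _    | yes _    | no ρ₃v≢0 = inj₂ (inj₂ (*-pos 0<c₃ (square-pos ρ₃v≢0)))
  ... | yes ρ₁v≡0 | yes ρ₂v≡0 | yes ρ₃v≡0 =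
    contradiction v≢0 (orthogonal-to-independent⇒zero ρ₁ ρ₂ ρ₃ det≢0 ρ₁v≡0 ρ₂v≡0 ρ₃v≡0)

dot-scaleʳ : ∀ x {y z} c → (∀ i → y i ≡ c * z i) → dot x y ≡ c * dot x z
dot-scaleʳ x {y} {z} c y≡cz = begin
  dot x y
    ≡⟨ cong₂ _+_ (cong₂ _+_ (cong (x 0F *_) (y≡cz 0F)) (cong (x 1F *_) (y≡cz 1F)))
                 (cong (x 2F *_) (y≡cz 2F)) ⟩
  x 0F * (c * z 0F) + x 1F * (c * z 1F) + x 2F * (c * z 2F)
    ≡⟨ polynomial (x 0F) (x 1F) (x 2F) (z 0F) (z 1F) (z 2F) c ⟩
  c * dot x z ∎
  where
  open ≡-Reasoning
  polynomial : ∀ x₀ x₁ x₂ z₀ z₁ z₂ c →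
    x₀ * (c * z₀) + x₁ * (c * z₁) + x₂ * (c * z₂) ≡ c * (x₀ * z₀ + x₁ * z₁ + x₂ * z₂)
  polynomial = solve-∀

dot-shiftʳ : ∀ w u k α → dot w (λ i → u i - α * k i) ≡ dot w u - α * dot w k
dot-shiftʳ w u k α = polynomial (w 0F) (w 1F) (w 2F) (u 0F) (u 1F) (u 2F) (k 0F) (k 1F) (k 2F) α
  where
  polynomial : ∀ w₀ w₁ w₂ u₀ u₁ u₂ k₀ k₁ k₂ α →
    w₀ * (u₀ - α * k₀) + w₁ * (u₁ - α * k₁) + w₂ * (u₂ - α * k₂)
    ≡ w₀ * u₀ + w₁ * u₁ + w₂ * u₂ - α * (w₀ * k₀ + w₁ * k₁ + w₂ * k₂)
  polynomial = solve-∀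

-- Bézout's identity and primitive vectors

sign-unit : ∀ i → ∃[ σ ] σ * i ≡ + ∣ i ∣
sign-unit (+ n)    = + 1 , ℤP.*-identityˡ (+ n)
sign-unit -[1+ n ] = - + 1 , cong +_ (ℕP.*-identityˡ (suc n))

ℕ-identity⇒ℤ : ∀ {a b c e f} → a ℕ.+ b ℕ.* c ≡ e ℕ.* f → + e * + f + - + b * + c ≡ + a
ℕ-identity⇒ℤ {a} {b} {c} {e} {f} a+bc≡ef = begin
  + e * + f + - + b * + c          ≡⟨ cong (_+ - + b * + c) ef≡a+bc ⟩
  + a + + b * + c + - + b * + c    ≡⟨ polynomial (+ a) (+ b) (+ c) ⟩
  + a                              ∎
  where
  open ≡-Reasoning
  ef≡a+bc : + e * + f ≡ + a + + b * + c
  ef≡a+bc = begin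
    + e * + f          ≡⟨ ℤP.pos-* e f ⟨
    + (e ℕ.* f)        ≡⟨ cong +_ a+bc≡ef ⟨
    + (a ℕ.+ b ℕ.* c)  ≡⟨ ℤP.pos-+ a (b ℕ.* c) ⟩
    + a + + (b ℕ.* c)  ≡⟨ cong (_+_ (+ a)) (ℤP.pos-* b c) ⟩
    + a + + b * + c    ∎
  polynomial : ∀ a b c → a + b * c + - b * c ≡ a
  polynomial = solve-∀

ℕ-bézout⇒ℤ : ∀ {d m n} → Bézout.Identity d m n → ∃[ u ] ∃[ v ] (u * + m + v * + n ≡ + d)
ℕ-bézout⇒ℤ {d} {m} {n} (Bézout.+- x y d+yn≡xm) = + x , - + y , ℕ-identity⇒ℤ {d} {y} {n} {x} {m} d+yn≡xm
ℕ-bézout⇒ℤ {d} {m} {n} (Bézout.-+ x y d+xm≡yn) =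
  - + x , + y , trans (ℤP.+-comm (- + x * + m) (+ y * + n)) (ℕ-identity⇒ℤ {d} {x} {m} {y} {n} d+xm≡yn)

bézout : ∀ m n → ∃[ g ] ∃[ u ] ∃[ v ] (u * m + v * n ≡ g × (g ∣ m) × (g ∣ n))
bézout m n with sign-unit m | sign-unit n | Bézout.lemma ∣ m ∣ ∣ n ∣
... | σ , σm≡∣m∣ | τ , τn≡∣n∣ | Bézout.result d gcd identity with ℕ-bézout⇒ℤ identity
...   | u , v , u∣m∣+v∣n∣≡d =
  + d , u * σ , v * τ , combination , proj₁ (GCD.commonDivisor gcd) , proj₂ (GCD.commonDivisor gcd)
  where
  open ≡-Reasoning
  combination : u * σ * m + v * τ * n ≡ + d
  combination = begin
    u * σ * m + v * τ * n          ≡⟨ cong₂ _+_ (ℤP.*-assoc u σ m) (ℤP.*-assoc v τ n) ⟩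
    u * (σ * m) + v * (τ * n)      ≡⟨ cong₂ (λ p q → u * p + v * q) σm≡∣m∣ τn≡∣n∣ ⟩
    u * + ∣ m ∣ + v * + ∣ n ∣      ≡⟨ u∣m∣+v∣n∣≡d ⟩
    + d                            ∎

unit-cases : ∀ {g} → ∣ g ∣ ≡ 1 → g ≡ + 1 ⊎ g ≡ - + 1
unit-cases {+ .1}      refl = inj₁ refl
unit-cases { -[1+ .0 ]} refl = inj₂ refl

unimodular-combination : (x : Vecℤ 2) → Primitive x → ∃[ u ] ∃[ v ] (u * x 0F + v * x 1F ≡ + 1)
unimodular-combination x prim with bézout (x 0F) (x 1F)
... | g , u , v , ux₀+vx₁≡g , g∣x₀ , g∣x₁
  with unit-cases {g} (ℕDiv.∣1⇒≡1 (prim g λ { 0F → g∣x₀ ; 1F → g∣x₁ }))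
...   | inj₁ refl = u , v , ux₀+vx₁≡g
...   | inj₂ refl = - u , - v , trans (polynomial u (x 0F) v (x 1F)) (cong -_ ux₀+vx₁≡g)
  where
  polynomial : ∀ u x₀ v x₁ → - u * x₀ + - v * x₁ ≡ - (u * x₀ + v * x₁)
  polynomial = solve-∀

basis-completion : (x : Vecℤ 2) → Primitive x → ∃[ y ] (x 0F * y 1F - x 1F * y 0F ≡ + 1)
basis-completion x prim with unimodular-combination x prim
... | u , v , ux₀+vx₁≡1 = vec2 (- v) u , trans (polynomial (x 0F) (x 1F) u v) ux₀+vx₁≡1
  where
  polynomial : ∀ x₀ x₁ u v → x₀ * u - x₁ * - v ≡ u * x₀ + v * x₁
  polynomial = solve-∀

PrimitiveDecomposition : Vecℤ 3 → Set
PrimitiveDecomposition r = ∃[ g ] ∃[ k ] ∃[ w ] (g ≢ + 0 × (∀ i → r i ≡ g * k i) × dot w k ≡ + 1)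

primitive-decomposition : (r : Vecℤ 3) → NonZeroVec r → PrimitiveDecomposition r
primitive-decomposition r (j , rⱼ≢0) with bézout (r 0F) (r 1F)
... | g₁ , u₀ , u₁ , u₀r₀+u₁r₁≡g₁ , g₁∣r₀ , g₁∣r₁ with bézout g₁ (r 2F)
...   | g , v , u₂ , vg₁+u₂r₂≡g , g∣g₁ , g∣r₂ = g , k , w , g≢0 , r≡gk , w·k≡1
  where
  open ≡-Reasoning
  g∣r : ∀ i → g ∣ r i
  g∣r 0F = ℕDiv.∣-trans g∣g₁ g₁∣r₀
  g∣r 1F = ℕDiv.∣-trans g∣g₁ g₁∣r₁
  g∣r 2F = g∣r₂
  g∣ˢr : ∀ i → g Signed.∣ r i
  g∣ˢr i = Signed.∣ᵤ⇒∣ {g} {r i} (g∣r i)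
  k : Vecℤ 3
  k i = Signed._∣_.quotient (g∣ˢr i)
  r≡gk : ∀ i → r i ≡ g * k i
  r≡gk i = trans (Signed._∣_.equality (g∣ˢr i)) (ℤP.*-comm (k i) g)
  g≢0 : g ≢ + 0
  g≢0 g≡0 = rⱼ≢0 (trans (r≡gk j) (cong (_* k j) g≡0))
  w : Vecℤ 3
  w = vec3 (v * u₀) (v * u₁) u₂
  w·r≡g : dot w r ≡ g
  w·r≡g = begin
    v * u₀ * r 0F + v * u₁ * r 1F + u₂ * r 2F    ≡⟨ polynomial v u₀ (r 0F) u₁ (r 1F) u₂ (r 2F) ⟩
    v * (u₀ * r 0F + u₁ * r 1F) + u₂ * r 2F      ≡⟨ cong (λ g₁′ → v * g₁′ + u₂ * r 2F) u₀r₀+u₁r₁≡g₁ ⟩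
    v * g₁ + u₂ * r 2F                           ≡⟨ vg₁+u₂r₂≡g ⟩
    g                                            ∎
    where
    polynomial : ∀ v u₀ r₀ u₁ r₁ u₂ r₂ →
      v * u₀ * r₀ + v * u₁ * r₁ + u₂ * r₂ ≡ v * (u₀ * r₀ + u₁ * r₁) + u₂ * r₂
    polynomial = solve-∀
  w·k≡1 : dot w k ≡ + 1
  w·k≡1 = ℤP.*-cancelˡ-≡ g (dot w k) (+ 1) {{≢-nonZero g≢0}} (begin
    g * dot w k   ≡⟨ dot-scaleʳ w {r} {k} g r≡gk ⟨
    dot w r       ≡⟨ w·r≡g ⟩
    g             ≡⟨ ℤP.*-identityʳ g ⟨
    g * + 1       ∎)

-- Rounding

quadruple-square≤ : ∀ x e {m} → x * x ≡ + e * + e → e ℕ.+ e ℕ.≤ m → + 4 * (x * x) ≤ + m * + m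
quadruple-square≤ x e {m} x²≡e² 2e≤m = begin
  + 4 * (x * x)                  ≡⟨ cong (+ 4 *_) x²≡e² ⟩
  + 4 * (+ e * + e)              ≡⟨ polynomial (+ e) ⟩
  (+ e + + e) * (+ e + + e)      ≡⟨ cong₂ _*_ (ℤP.pos-+ e e) (ℤP.pos-+ e e) ⟨
  + (e ℕ.+ e) * + (e ℕ.+ e)      ≡⟨ ℤP.pos-* (e ℕ.+ e) (e ℕ.+ e) ⟨
  + ((e ℕ.+ e) ℕ.* (e ℕ.+ e))    ≤⟨ +≤+ (ℕP.*-mono-≤ 2e≤m 2e≤m) ⟩
  + (m ℕ.* m)                    ≡⟨ ℤP.pos-* m m ⟩
  + m * + m                      ∎
  where
  open ℤP.≤-Reasoning
  polynomial : ∀ e → + 4 * (e * e) ≡ (e + e) * (e + e)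
  polynomial = solve-∀

nearest-multiple : ∀ {a} → + 0 < a → ∀ n → ∃[ t ] + 4 * ((a * t - n) * (a * t - n)) ≤ a * a
nearest-multiple {+[1+ k ]} (+<+ _) n = [ round-down , round-up ]′ (ℕP.≤-total ρ ρ′)
  where
  open ≡-Reasoning
  m ρ ρ′ : ℕ
  m  = suc k
  ρ  = n %ℕ m
  ρ′ = m ℕ.∸ ρ
  q : ℤ
  q = n /ℕ m
  n≡ρ+qm : n ≡ + ρ + q * + m
  n≡ρ+qm = a≡a%ℕn+[a/ℕn]*n n m
  ρ+ρ′≡m : ρ ℕ.+ ρ′ ≡ m
  ρ+ρ′≡m = ℕP.m+[n∸m]≡n (ℕP.<⇒≤ (n%ℕd<d n m))
  below : + m * q - n ≡ - + ρ
  below = begin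
    + m * q - n                ≡⟨ cong (_-_ (+ m * q)) n≡ρ+qm ⟩
    + m * q - (+ ρ + q * + m)  ≡⟨ polynomial (+ m) q (+ ρ) ⟩
    - + ρ                      ∎
    where
    polynomial : ∀ m q ρ → m * q - (ρ + q * m) ≡ - ρ
    polynomial = solve-∀
  above : + m * (q + + 1) - n ≡ + ρ′
  above = begin
    + m * (q + + 1) - n                ≡⟨ cong (_-_ (+ m * (q + + 1))) n≡ρ+qm ⟩
    + m * (q + + 1) - (+ ρ + q * + m)  ≡⟨ polynomial (+ m) q (+ ρ) ⟩
    + m - + ρ                          ≡⟨ cong (_- + ρ) (trans (cong +_ (sym ρ+ρ′≡m)) (ℤP.pos-+ ρ ρ′)) ⟩
    + ρ + + ρ′ - + ρ                   ≡⟨ cancel (+ ρ) (+ ρ′) ⟩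
    + ρ′                               ∎
    where
    polynomial : ∀ m q ρ → m * (q + + 1) - (ρ + q * m) ≡ m - ρ
    polynomial = solve-∀
    cancel : ∀ a b → a + b - a ≡ b
    cancel = solve-∀
  Close : ℤ → Set
  Close t = + 4 * ((+ m * t - n) * (+ m * t - n)) ≤ + m * + m
  round-down : ρ ℕ.≤ ρ′ → ∃[ t ] Close t
  round-down ρ≤ρ′ = q , quadruple-square≤ (+ m * q - n) ρ
                          (trans (cong (λ x → x * x) below) (neg-square (+ ρ)))
                          (subst (ρ ℕ.+ ρ ℕ.≤_) ρ+ρ′≡m (ℕP.+-monoʳ-≤ ρ ρ≤ρ′))
    where
    neg-square : ∀ x → - x * - x ≡ x * x
    neg-square = solve-∀
  round-up : ρ′ ℕ.≤ ρ → ∃[ t ] Close t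
  round-up ρ′≤ρ = q + + 1 , quadruple-square≤ (+ m * (q + + 1) - n) ρ′ (cong (λ x → x * x) above)
                              (subst (ρ′ ℕ.+ ρ′ ℕ.≤_) ρ+ρ′≡m (ℕP.+-monoˡ-≤ ρ′ ρ′≤ρ))

sandwich⇒nonneg : ∀ {a s d₁ d₂} → + 4 * (s * s) ≤ a * a → a * a ≤ + 4 * d₁ * d₂ → + 0 ≤ d₁ * d₂ - s * s
sandwich⇒nonneg {a} {s} {d₁} {d₂} 4s²≤a² a²≤4d₁d₂ =
  ℤP.i≤j⇒0≤j-i (ℤP.*-cancelˡ-≤-pos (s * s) (d₁ * d₂) (+ 4)
    (ℤP.≤-trans 4s²≤a² (subst (a * a ≤_) (ℤP.*-assoc (+ 4) d₁ d₂) a²≤4d₁d₂)))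

unit : ∀ {n} → Fin n → Vecℤ n
unit zero    zero    = + 1
unit zero    (suc j) = + 0
unit (suc i) zero    = + 0
unit (suc i) (suc j) = unit i j

Σℤ-cong : ∀ n {f g : Fin n → ℤ} → (∀ i → f i ≡ g i) → Σℤ n f ≡ Σℤ n g
Σℤ-cong zero    f≗g = refl
Σℤ-cong (suc n) f≗g = cong₂ _+_ (f≗g zero) (Σℤ-cong n (f≗g ∘ suc))

Σℤ-zero : ∀ n {f : Fin n → ℤ} → (∀ i → f i ≡ + 0) → Σℤ n f ≡ + 0
Σℤ-zero zero    f≗0 = refl
Σℤ-zero (suc n) f≗0 = cong₂ _+_ (f≗0 zero) (Σℤ-zero n (f≗0 ∘ suc))

Σℤ-*ˡ : ∀ n c (f : Fin n → ℤ) → Σℤ n (λ i → c * f i) ≡ c * Σℤ n f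
Σℤ-*ˡ zero    c f = sym (ℤP.*-zeroʳ c)
Σℤ-*ˡ (suc n) c f = trans (cong (_+_ (c * f zero)) (Σℤ-*ˡ n c (f ∘ suc)))
                          (sym (ℤP.*-distribˡ-+ c (f zero) (Σℤ n (f ∘ suc))))

Σℤ-*-unit : ∀ n (f : Fin n → ℤ) j → Σℤ n (λ i → f i * unit j i) ≡ f j
Σℤ-*-unit (suc n) f zero = trans
  (cong₂ _+_ (ℤP.*-identityʳ (f zero)) (Σℤ-zero n (λ i → ℤP.*-zeroʳ (f (suc i)))))
  (ℤP.+-identityʳ (f zero))
Σℤ-*-unit (suc n) f (suc j) = trans
  (cong₂ _+_ (ℤP.*-zeroʳ (f zero)) (Σℤ-*-unit n (f ∘ suc) j))
  (ℤP.+-identityˡ (f (suc j)))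

Σℤ-unit-* : ∀ n (f : Fin n → ℤ) j → Σℤ n (λ i → unit j i * f i) ≡ f j
Σℤ-unit-* n f j = trans (Σℤ-cong n (λ i → ℤP.*-comm (unit j i) (f i))) (Σℤ-*-unit n f j)

bilin-unit : ∀ {n} (G : Fin n → Fin n → ℤ) i j → bilin G (unit i) (unit j) ≡ G i j
bilin-unit {n} G i j = trans (Σℤ-cong n (λ k → Σℤ-*-unit n (λ l → unit i k * G k l) j))
                             (Σℤ-unit-* n (λ k → G k j) i)

bilin-cong : ∀ {n} {G H : Fin n → Fin n → ℤ} → (∀ i j → G i j ≡ H i j) →
             ∀ x y → bilin G x y ≡ bilin H x y
bilin-cong {n} G≗H x y =
  Σℤ-cong n (λ i → Σℤ-cong n (λ j → cong (λ g → x i * g * y j) (G≗H i j)))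

bilin-scaleʳ : ∀ {n} (G : Fin n → Fin n → ℤ) x {y z} c → (∀ j → y j ≡ c * z j) →
               bilin G x y ≡ c * bilin G x z
bilin-scaleʳ {n} G x {y} {z} c y≡cz = begin
  bilin G x y
    ≡⟨ Σℤ-cong n (λ i → Σℤ-cong n (λ j →
         trans (cong (_*_ (x i * G i j)) (y≡cz j)) (polynomial (x i * G i j) c (z j)))) ⟩
  Σℤ n (λ i → Σℤ n (λ j → c * (x i * G i j * z j)))
    ≡⟨ Σℤ-cong n (λ i → Σℤ-*ˡ n c (λ j → x i * G i j * z j)) ⟩
  Σℤ n (λ i → c * Σℤ n (λ j → x i * G i j * z j))
    ≡⟨ Σℤ-*ˡ n c (λ i → Σℤ n (λ j → x i * G i j * z j)) ⟩
  c * bilin G x z ∎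
  where
  open ≡-Reasoning
  polynomial : ∀ a c z → a * (c * z) ≡ c * (a * z)
  polynomial = solve-∀

record Isometry {m n} (G : Fin m → Fin m → ℤ) (H : Fin n → Fin n → ℤ) : Set where
  constructor isometry
  field
    map       : Vecℤ m → Vecℤ n
    isometric : ∀ x y → bilin H (map x) (map y) ≡ bilin G x y

isometry-trans : ∀ {m n k} {G : Fin m → Fin m → ℤ} {H : Fin n → Fin n → ℤ} {K : Fin k → Fin k → ℤ} →
                 Isometry G H → Isometry H K → Isometry G K
isometry-trans (isometry ψ ψ-isometric) (isometry χ χ-isometric) =
  isometry (χ ∘ ψ) (λ x y → trans (χ-isometric (ψ x) (ψ y)) (ψ-isometric x y))

isometry⇒represents : ∀ {m n} {ℓ : ZLattice m} {L : ZLattice n} →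
                      Isometry (gram ℓ) (gram L) → Represents L ℓ
isometry⇒represents {ℓ = ℓ} (isometry ψ ψ-isometric) =
  ψ ∘ unit , λ i j → trans (ψ-isometric (unit i) (unit j)) (bilin-unit (gram ℓ) i j)

-- Binary lattices

gram2 : ℤ → ℤ → ℤ → Fin 2 → Fin 2 → ℤ
gram2 a b c 0F 0F = a
gram2 a b c 0F 1F = b
gram2 a b c 1F 0F = b
gram2 a b c 1F 1F = c

bilin₂-rows : (G : Fin 2 → Fin 2 → ℤ) (x y : Vecℤ 2) →
  bilin G x y ≡ x 0F * (G 0F 0F * y 0F + G 0F 1F * y 1F) + x 1F * (G 1F 0F * y 0F + G 1F 1F * y 1F)
bilin₂-rows G x y = polynomial (G 0F 0F) (G 0F 1F) (G 1F 0F) (G 1F 1F) (x 0F) (x 1F) (y 0F) (y 1F)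
  where
  -- the left-hand side is bilin G x y unfolded, with the trailing zeros of Σℤ
  polynomial : ∀ g₀₀ g₀₁ g₁₀ g₁₁ x₀ x₁ y₀ y₁ →
    x₀ * g₀₀ * y₀ + (x₀ * g₀₁ * y₁ + + 0) + (x₁ * g₁₀ * y₀ + (x₁ * g₁₁ * y₁ + + 0) + + 0)
    ≡ x₀ * (g₀₀ * y₀ + g₀₁ * y₁) + x₁ * (g₁₀ * y₀ + g₁₁ * y₁)
  polynomial = solve-∀

module BinaryLattice (ℓ : ZLattice 2) where

  p q r : ℤ
  p = gram ℓ 0F 0F
  q = gram ℓ 0F 1F
  r = gram ℓ 1F 1F

  gram≗gram2 : ∀ i j → gram ℓ i j ≡ gram2 p q r i j
  gram≗gram2 0F 0F = refl
  gram≗gram2 0F 1F = refl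
  gram≗gram2 1F 0F = symm ℓ 1F 0F
  gram≗gram2 1F 1F = refl

  form : Vecℤ 2 → Vecℤ 2 → ℤ
  form x y = x 0F * (p * y 0F + q * y 1F) + x 1F * (q * y 0F + r * y 1F)

  B≡form : ∀ x y → B ℓ x y ≡ form x y
  B≡form x y = trans (bilin-cong gram≗gram2 x y) (bilin₂-rows (gram2 p q r) x y)

  det2≡pr-q² : det2 ℓ ≡ p * r - q * q
  det2≡pr-q² = cong (λ q′ → p * r - q * q′) (symm ℓ 1F 0F)

  det2-pos : + 0 < det2 ℓ
  det2-pos = subst (+ 0 <_) (sym det2≡pr-q²) (pos-*-cancel 0<p 0<p·det)
    where
    0<p : + 0 < p
    0<p = subst (+ 0 <_) (bilin-unit (gram ℓ) 0F 0F) (posdef ℓ (unit 0F) (0F , λ ()))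
    polynomial : ∀ p q r → - q * (p * - q + q * p) + p * (q * - q + r * p) ≡ p * (p * r - q * q)
    polynomial = solve-∀
    0<p·det : + 0 < p * (p * r - q * q)
    0<p·det = subst (+ 0 <_) (trans (B≡form v v) (polynomial p q r))
                    (posdef ℓ v (1F , λ p≡0 → ℤP.<⇒≢ 0<p (sym p≡0)))
      where
      v : Vecℤ 2
      v = vec2 (- q) p

  NormalForm : ℤ → Set
  NormalForm a = ∃[ b ] ∃[ c ] (a * c - b * b ≡ det2 ℓ × Isometry (gram ℓ) (gram2 a b c))

  change-of-basis : ∀ x y → x 0F * y 1F - x 1F * y 0F ≡ + 1 → NormalForm (form x x)
  change-of-basis x y δ≡1 = form x y , form y y , det-identity , isometry ψ ψ-isometric
    where
    open ≡-Reasoning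

    δ : ℤ
    δ = x 0F * y 1F - x 1F * y 0F

    square-δ : ∀ z → δ * δ * z ≡ z
    square-δ z = trans (cong (λ d → d * d * z) δ≡1) (ℤP.*-identityˡ z)

    det-polynomial : ∀ p q r x₀ x₁ y₀ y₁ →
      let F u₀ u₁ v₀ v₁ = u₀ * (p * v₀ + q * v₁) + u₁ * (q * v₀ + r * v₁)
      in F x₀ x₁ x₀ x₁ * F y₀ y₁ y₀ y₁ - F x₀ x₁ y₀ y₁ * F x₀ x₁ y₀ y₁
         ≡ (x₀ * y₁ - x₁ * y₀) * (x₀ * y₁ - x₁ * y₀) * (p * r - q * q)
    det-polynomial = solve-∀

    det-identity : form x x * form y y - form x y * form x y ≡ det2 ℓ
    det-identity = begin
      form x x * form y y - form x y * form x y  ≡⟨ det-polynomial p q r (x 0F) (x 1F) (y 0F) (y 1F) ⟩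
      δ * δ * (p * r - q * q)                    ≡⟨ square-δ (p * r - q * q) ⟩
      p * r - q * q                              ≡⟨ det2≡pr-q² ⟨
      det2 ℓ                                     ∎

    -- ψ is the adjugate of the basis change (x, y), so it maps z to the coordinates of δ z in that basis
    ψ : Vecℤ 2 → Vecℤ 2
    ψ z = vec2 (y 1F * z 0F - y 0F * z 1F) (x 0F * z 1F - x 1F * z 0F)

    isometry-polynomial : ∀ p q r x₀ x₁ y₀ y₁ z₀ z₁ z₀′ z₁′ →
      let F u₀ u₁ v₀ v₁ = u₀ * (p * v₀ + q * v₁) + u₁ * (q * v₀ + r * v₁)
          a = F x₀ x₁ x₀ x₁
          b = F x₀ x₁ y₀ y₁
          c = F y₀ y₁ y₀ y₁
          α = y₁ * z₀ - y₀ * z₁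
          β = x₀ * z₁ - x₁ * z₀
          α′ = y₁ * z₀′ - y₀ * z₁′
          β′ = x₀ * z₁′ - x₁ * z₀′
      in α * (a * α′ + b * β′) + β * (b * α′ + c * β′)
         ≡ (x₀ * y₁ - x₁ * y₀) * (x₀ * y₁ - x₁ * y₀) * F z₀ z₁ z₀′ z₁′
    isometry-polynomial = solve-∀

    ψ-isometric : ∀ z z′ → bilin (gram2 (form x x) (form x y) (form y y)) (ψ z) (ψ z′) ≡ B ℓ z z′
    ψ-isometric z z′ = begin
      bilin (gram2 (form x x) (form x y) (form y y)) (ψ z) (ψ z′)
        ≡⟨ bilin₂-rows (gram2 (form x x) (form x y) (form y y)) (ψ z) (ψ z′) ⟩
      ψ z 0F * (form x x * ψ z′ 0F + form x y * ψ z′ 1F) + ψ z 1F * (form x y * ψ z′ 0F + form y y * ψ z′ 1F)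
        ≡⟨ isometry-polynomial p q r (x 0F) (x 1F) (y 0F) (y 1F) (z 0F) (z 1F) (z′ 0F) (z′ 1F) ⟩
      δ * δ * form z z′  ≡⟨ square-δ (form z z′) ⟩
      form z z′          ≡⟨ B≡form z z′ ⟨
      B ℓ z z′           ∎

  normal-form : ∀ a → PrimRepresents ℓ a → NormalForm a
  normal-form a (x , prim , x²≡a) =
    let y , δ≡1 = basis-completion x prim
    in subst NormalForm (trans (sym (B≡form x x)) x²≡a) (change-of-basis x y δ≡1)

-- Ternary forms

gram3 : (a b₁ b₂ c₁ c₂ t : ℤ) → Fin 3 → Fin 3 → ℤ
gram3 a b₁ b₂ c₁ c₂ t 0F 0F = a
gram3 a b₁ b₂ c₁ c₂ t 0F 1F = b₁
gram3 a b₁ b₂ c₁ c₂ t 0F 2F = b₂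
gram3 a b₁ b₂ c₁ c₂ t 1F 0F = b₁
gram3 a b₁ b₂ c₁ c₂ t 1F 1F = c₁
gram3 a b₁ b₂ c₁ c₂ t 1F 2F = t
gram3 a b₁ b₂ c₁ c₂ t 2F 0F = b₂
gram3 a b₁ b₂ c₁ c₂ t 2F 1F = t
gram3 a b₁ b₂ c₁ c₂ t 2F 2F = c₂

gram3-symm : ∀ a b₁ b₂ c₁ c₂ t i j → gram3 a b₁ b₂ c₁ c₂ t i j ≡ gram3 a b₁ b₂ c₁ c₂ t j i
gram3-symm a b₁ b₂ c₁ c₂ t 0F 0F = refl
gram3-symm a b₁ b₂ c₁ c₂ t 0F 1F = refl
gram3-symm a b₁ b₂ c₁ c₂ t 0F 2F = refl
gram3-symm a b₁ b₂ c₁ c₂ t 1F 0F = refl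
gram3-symm a b₁ b₂ c₁ c₂ t 1F 1F = refl
gram3-symm a b₁ b₂ c₁ c₂ t 1F 2F = refl
gram3-symm a b₁ b₂ c₁ c₂ t 2F 0F = refl
gram3-symm a b₁ b₂ c₁ c₂ t 2F 1F = refl
gram3-symm a b₁ b₂ c₁ c₂ t 2F 2F = refl

bilin₃-rows : (G : Fin 3 → Fin 3 → ℤ) (x y : Vecℤ 3) → bilin G x y ≡ dot x (λ i → dot (G i) y)
bilin₃-rows G x y = polynomial
  (G 0F 0F) (G 0F 1F) (G 0F 2F) (G 1F 0F) (G 1F 1F) (G 1F 2F) (G 2F 0F) (G 2F 1F) (G 2F 2F)
  (x 0F) (x 1F) (x 2F) (y 0F) (y 1F) (y 2F)
  where
  -- the left-hand side is bilin G x y unfolded, with the trailing zeros of Σℤ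
  polynomial : ∀ g₀₀ g₀₁ g₀₂ g₁₀ g₁₁ g₁₂ g₂₀ g₂₁ g₂₂ x₀ x₁ x₂ y₀ y₁ y₂ →
    let row x g₀ g₁ g₂ = x * g₀ * y₀ + (x * g₁ * y₁ + (x * g₂ * y₂ + + 0)) in
    row x₀ g₀₀ g₀₁ g₀₂ + (row x₁ g₁₀ g₁₁ g₁₂ + (row x₂ g₂₀ g₂₁ g₂₂ + + 0))
    ≡ x₀ * (g₀₀ * y₀ + g₀₁ * y₁ + g₀₂ * y₂) + x₁ * (g₁₀ * y₀ + g₁₁ * y₁ + g₁₂ * y₂)
      + x₂ * (g₂₀ * y₀ + g₂₁ * y₁ + g₂₂ * y₂)
  polynomial = solve-∀

module TernaryForm (a b₁ b₂ c₁ c₂ t : ℤ) where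

  Q : Fin 3 → Fin 3 → ℤ
  Q = gram3 a b₁ b₂ c₁ c₂ t

  form : Vecℤ 3 → Vecℤ 3 → ℤ
  form x y = dot x (λ i → dot (Q i) y)

  embed₁₂ : Isometry (gram2 a b₁ c₁) Q
  embed₁₂ = isometry ψ λ z z′ → trans (bilin₃-rows Q (ψ z) (ψ z′))
                           (trans (polynomial a b₁ b₂ c₁ c₂ t (z 0F) (z 1F) (z′ 0F) (z′ 1F))
                                  (sym (bilin₂-rows (gram2 a b₁ c₁) z z′)))
    where
    ψ : Vecℤ 2 → Vecℤ 3
    ψ z = vec3 (z 0F) (z 1F) (+ 0)
    polynomial : ∀ a b₁ b₂ c₁ c₂ t z₀ z₁ z₀′ z₁′ →
      z₀ * (a * z₀′ + b₁ * z₁′ + b₂ * + 0) + z₁ * (b₁ * z₀′ + c₁ * z₁′ + t * + 0)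
        + + 0 * (b₂ * z₀′ + t * z₁′ + c₂ * + 0)
      ≡ z₀ * (a * z₀′ + b₁ * z₁′) + z₁ * (b₁ * z₀′ + c₁ * z₁′)
    polynomial = solve-∀

  embed₁₃ : Isometry (gram2 a b₂ c₂) Q
  embed₁₃ = isometry ψ λ z z′ → trans (bilin₃-rows Q (ψ z) (ψ z′))
                           (trans (polynomial a b₁ b₂ c₁ c₂ t (z 0F) (z 1F) (z′ 0F) (z′ 1F))
                                  (sym (bilin₂-rows (gram2 a b₂ c₂) z z′)))
    where
    ψ : Vecℤ 2 → Vecℤ 3
    ψ z = vec3 (z 0F) (+ 0) (z 1F)
    polynomial : ∀ a b₁ b₂ c₁ c₂ t z₀ z₁ z₀′ z₁′ →
      z₀ * (a * z₀′ + b₁ * + 0 + b₂ * z₁′) + + 0 * (b₁ * z₀′ + c₁ * + 0 + t * z₁′)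
        + z₁ * (b₂ * z₀′ + t * + 0 + c₂ * z₁′)
      ≡ z₀ * (a * z₀′ + b₂ * z₁′) + z₁ * (b₂ * z₀′ + c₂ * z₁′)
    polynomial = solve-∀

  d₁ d₂ s Δ : ℤ
  d₁ = a * c₁ - b₁ * b₁
  d₂ = a * c₂ - b₂ * b₂
  s  = a * t - b₁ * b₂
  -- Δ = a · det Q
  Δ  = d₁ * d₂ - s * s

  ρ₁ ρ₂ e₂ : Vecℤ 3
  ρ₁ = vec3 a b₁ b₂
  ρ₂ = vec3 (+ 0) d₁ s
  e₂ = vec3 (+ 0) (+ 0) (+ 1)

  lagrange : ∀ v → a * d₁ * bilin Q v v
    ≡ d₁ * (dot ρ₁ v * dot ρ₁ v) + + 1 * (dot ρ₂ v * dot ρ₂ v) + Δ * (dot e₂ v * dot e₂ v)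
  lagrange v = trans (cong (a * d₁ *_) (bilin₃-rows Q v v))
                     (polynomial a b₁ b₂ c₁ c₂ t (v 0F) (v 1F) (v 2F))
    where
    polynomial : ∀ a b₁ b₂ c₁ c₂ t v₀ v₁ v₂ →
      let d₁ = a * c₁ - b₁ * b₁
          s  = a * t - b₁ * b₂
          L  = a * v₀ + b₁ * v₁ + b₂ * v₂
          M  = + 0 * v₀ + d₁ * v₁ + s * v₂
          Z  = + 0 * v₀ + + 0 * v₁ + + 1 * v₂
      in a * d₁ * (v₀ * (a * v₀ + b₁ * v₁ + b₂ * v₂) + v₁ * (b₁ * v₀ + c₁ * v₁ + t * v₂)
                   + v₂ * (b₂ * v₀ + t * v₁ + c₂ * v₂))
         ≡ d₁ * (L * L) + + 1 * (M * M) + (d₁ * (a * c₂ - b₂ * b₂) - s * s) * (Z * Z)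
    polynomial = solve-∀

  r : Vecℤ 3
  r = cross ρ₁ ρ₂

  r₂≡ad₁ : r 2F ≡ a * d₁
  r₂≡ad₁ = trans (cong (λ z → a * d₁ - z) (ℤP.*-zeroʳ b₁)) (ℤP.+-identityʳ (a * d₁))

  det[ρ₁,ρ₂,e₂]≡r₂ : det3 ρ₁ ρ₂ e₂ ≡ r 2F
  det[ρ₁,ρ₂,e₂]≡r₂ = polynomial (r 0F) (r 1F) (r 2F)
    where
    polynomial : ∀ r₀ r₁ r₂ → + 0 * r₀ + + 0 * r₁ + + 1 * r₂ ≡ r₂
    polynomial = solve-∀

  realizable-nondegenerate : + 0 < a → + 0 < d₁ → + 0 < Δ → Σ (ZLattice 3) λ N → Isometry Q (gram N)
  realizable-nondegenerate 0<a 0<d₁ 0<Δ = N , isometry (λ v → v) (λ x y → refl)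
    where
    det≢0 : det3 ρ₁ ρ₂ e₂ ≢ + 0
    det≢0 det≡0 = ℤP.<⇒≢ (*-pos 0<a 0<d₁) (trans (sym det≡0) (trans det[ρ₁,ρ₂,e₂]≡r₂ r₂≡ad₁))
    N : ZLattice 3
    N = record
      { gram   = Q
      ; symm   = gram3-symm a b₁ b₂ c₁ c₂ t
      ; posdef = λ v v≢0 → positive-of-squares {q = bilin Q v v} ρ₁ ρ₂ e₂ (*-pos 0<a 0<d₁) 0<d₁ 0<1 0<Δ
                             det≢0 v≢0 (ℤP.≤-reflexive (sym (lagrange v)))
      }

  radical : ∀ x → bilin Q x r ≡ x 2F * Δ
  radical x = trans (bilin₃-rows Q x r) (polynomial a b₁ b₂ c₁ c₂ t (x 0F) (x 1F) (x 2F))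
    where
    polynomial : ∀ a b₁ b₂ c₁ c₂ t x₀ x₁ x₂ →
      let d₁ = a * c₁ - b₁ * b₁
          s  = a * t - b₁ * b₂
          r₀ = b₁ * s - b₂ * d₁
          r₁ = b₂ * + 0 - a * s
          r₂ = a * d₁ - b₁ * + 0
      in x₀ * (a * r₀ + b₁ * r₁ + b₂ * r₂) + x₁ * (b₁ * r₀ + c₁ * r₁ + t * r₂)
           + x₂ * (b₂ * r₀ + t * r₁ + c₂ * r₂)
         ≡ x₂ * (d₁ * (a * c₂ - b₂ * b₂) - s * s)
    polynomial = solve-∀

  Q+ww : Vecℤ 3 → Fin 3 → Fin 3 → ℤ
  Q+ww w = gram3 (a + w 0F * w 0F) (b₁ + w 0F * w 1F) (b₂ + w 0F * w 2F)
                 (c₁ + w 1F * w 1F) (c₂ + w 2F * w 2F) (t + w 1F * w 2F)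

  rank-one-update : ∀ w x y → bilin (Q+ww w) x y ≡ bilin Q x y + dot w x * dot w y
  rank-one-update w x y = begin
    bilin (Q+ww w) x y                  ≡⟨ bilin₃-rows (Q+ww w) x y ⟩
    dot x (λ i → dot (Q+ww w i) y)      ≡⟨ polynomial a b₁ b₂ c₁ c₂ t (w 0F) (w 1F) (w 2F)
                                                      (x 0F) (x 1F) (x 2F) (y 0F) (y 1F) (y 2F) ⟩
    form x y + dot w x * dot w y        ≡⟨ cong (_+ dot w x * dot w y) (bilin₃-rows Q x y) ⟨
    bilin Q x y + dot w x * dot w y     ∎
    where
    open ≡-Reasoning
    polynomial : ∀ a b₁ b₂ c₁ c₂ t w₀ w₁ w₂ x₀ x₁ x₂ y₀ y₁ y₂ →
      let F a b₁ b₂ c₁ c₂ t = x₀ * (a * y₀ + b₁ * y₁ + b₂ * y₂) + x₁ * (b₁ * y₀ + c₁ * y₁ + t * y₂)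
                                + x₂ * (b₂ * y₀ + t * y₁ + c₂ * y₂)
      in F (a + w₀ * w₀) (b₁ + w₀ * w₁) (b₂ + w₀ * w₂) (c₁ + w₁ * w₁) (c₂ + w₂ * w₂) (t + w₁ * w₂)
         ≡ F a b₁ b₂ c₁ c₂ t + (w₀ * x₀ + w₁ * x₁ + w₂ * x₂) * (w₀ * y₀ + w₁ * y₁ + w₂ * y₂)
    polynomial = solve-∀

  translation-along-radical : ∀ k → (∀ x → bilin Q x k ≡ + 0) →
    ∀ u v α β → bilin Q (λ i → u i - α * k i) (λ i → v i - β * k i) ≡ bilin Q u v
  translation-along-radical k k-radical u v α β = begin
    bilin Q (λ i → u i - α * k i) (λ i → v i - β * k i)
      ≡⟨ bilin₃-rows Q (λ i → u i - α * k i) (λ i → v i - β * k i) ⟩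
    form (λ i → u i - α * k i) (λ i → v i - β * k i)
      ≡⟨ polynomial a b₁ b₂ c₁ c₂ t (u 0F) (u 1F) (u 2F) (v 0F) (v 1F) (v 2F) (k 0F) (k 1F) (k 2F) α β ⟩
    form u v - β * form u k - α * form v k + α * β * form k k
      ≡⟨ cong₂ _+_ (cong₂ _-_ (cong (λ z → form u v - β * z) (form-radical u)) (cong (α *_) (form-radical v)))
                   (cong (α * β *_) (form-radical k)) ⟩
    form u v - β * + 0 - α * + 0 + α * β * + 0
      ≡⟨ drop-zeros (form u v) α β ⟩
    form u v
      ≡⟨ bilin₃-rows Q u v ⟨
    bilin Q u v ∎
    where
    open ≡-Reasoning
    form-radical : ∀ x → form x k ≡ + 0
    form-radical x = trans (sym (bilin₃-rows Q x k)) (k-radical x)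
    drop-zeros : ∀ z α β → z - β * + 0 - α * + 0 + α * β * + 0 ≡ z
    drop-zeros = solve-∀
    polynomial : ∀ a b₁ b₂ c₁ c₂ t u₀ u₁ u₂ v₀ v₁ v₂ k₀ k₁ k₂ α β →
      let F x₀ x₁ x₂ y₀ y₁ y₂ = x₀ * (a * y₀ + b₁ * y₁ + b₂ * y₂) + x₁ * (b₁ * y₀ + c₁ * y₁ + t * y₂)
                                  + x₂ * (b₂ * y₀ + t * y₁ + c₂ * y₂)
      in F (u₀ - α * k₀) (u₁ - α * k₁) (u₂ - α * k₂) (v₀ - β * k₀) (v₁ - β * k₁) (v₂ - β * k₂)
         ≡ F u₀ u₁ u₂ v₀ v₁ v₂ - β * F u₀ u₁ u₂ k₀ k₁ k₂ - α * F v₀ v₁ v₂ k₀ k₁ k₂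
           + α * β * F k₀ k₁ k₂ k₀ k₁ k₂
    polynomial = solve-∀

  realizable-degenerate : + 0 < a → + 0 < d₁ → Δ ≡ + 0 → Σ (ZLattice 3) λ N → Isometry Q (gram N)
  realizable-degenerate 0<a 0<d₁ Δ≡0 =
    from-decomposition (primitive-decomposition r (2F , r₂≢0))
    where
    r₂≢0 : r 2F ≢ + 0
    r₂≢0 r₂≡0 = ℤP.<⇒≢ (*-pos 0<a 0<d₁) (trans (sym r₂≡0) r₂≡ad₁)

    from-decomposition : PrimitiveDecomposition r → Σ (ZLattice 3) λ N → Isometry Q (gram N)
    from-decomposition (g , k , w , g≢0 , r≡gk , w·k≡1) = N , isometry φ φ-isometric
      where
      open ≡-Reasoning
      k-radical : ∀ x → bilin Q x k ≡ + 0
      k-radical x = [ (λ g≡0 → contradiction g≡0 g≢0) , (λ Bxk≡0 → Bxk≡0) ]′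
                    (ℤP.i*j≡0⇒i≡0∨j≡0 g (begin
                      g * bilin Q x k  ≡⟨ bilin-scaleʳ Q x g r≡gk ⟨
                      bilin Q x r      ≡⟨ radical x ⟩
                      x 2F * Δ         ≡⟨ cong (x 2F *_) Δ≡0 ⟩
                      x 2F * + 0       ≡⟨ ℤP.*-zeroʳ (x 2F) ⟩
                      + 0              ∎))

      det≢0 : det3 ρ₁ ρ₂ w ≢ + 0
      det≢0 det≡0 = g≢0 (begin
        g               ≡⟨ ℤP.*-identityʳ g ⟨
        g * + 1         ≡⟨ cong (g *_) w·k≡1 ⟨
        g * dot w k     ≡⟨ dot-scaleʳ w {r} {k} g r≡gk ⟨
        det3 ρ₁ ρ₂ w    ≡⟨ det≡0 ⟩
        + 0             ∎)

      N : ZLattice 3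
      N = record
        { gram   = Q+ww w
        ; symm   = gram3-symm (a + w 0F * w 0F) (b₁ + w 0F * w 1F) (b₂ + w 0F * w 2F)
                              (c₁ + w 1F * w 1F) (c₂ + w 2F * w 2F) (t + w 1F * w 2F)
        ; posdef = positive
        }
        where
        positive : ∀ v → NonZeroVec v → + 0 < bilin (Q+ww w) v v
        positive v v≢0 = positive-of-squares {q = bilin (Q+ww w) v v} ρ₁ ρ₂ w
                           (*-pos 0<a 0<d₁) 0<d₁ 0<1 (*-pos 0<a 0<d₁) det≢0 v≢0 (ℤP.≤-reflexive (sym squares))
          where
          L M W Z : ℤ
          L = dot ρ₁ v
          M = dot ρ₂ v
          W = dot w v
          Z = dot e₂ v
          squares : a * d₁ * bilin (Q+ww w) v v ≡ d₁ * (L * L) + + 1 * (M * M) + a * d₁ * (W * W)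
          squares = begin
            a * d₁ * bilin (Q+ww w) v v
              ≡⟨ cong (a * d₁ *_) (rank-one-update w v v) ⟩
            a * d₁ * (bilin Q v v + W * W)
              ≡⟨ ℤP.*-distribˡ-+ (a * d₁) (bilin Q v v) (W * W) ⟩
            a * d₁ * bilin Q v v + a * d₁ * (W * W)
              ≡⟨ cong (_+ a * d₁ * (W * W)) (lagrange v) ⟩
            d₁ * (L * L) + + 1 * (M * M) + Δ * (Z * Z) + a * d₁ * (W * W)
              ≡⟨ cong (λ δ → d₁ * (L * L) + + 1 * (M * M) + δ * (Z * Z) + a * d₁ * (W * W)) Δ≡0 ⟩
            d₁ * (L * L) + + 1 * (M * M) + + 0 + a * d₁ * (W * W)
              ≡⟨ cong (_+ a * d₁ * (W * W)) (ℤP.+-identityʳ (d₁ * (L * L) + + 1 * (M * M))) ⟩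
            d₁ * (L * L) + + 1 * (M * M) + a * d₁ * (W * W)
              ∎

      φ : Vecℤ 3 → Vecℤ 3
      φ u i = u i - dot w u * k i

      w·φ≡0 : ∀ u → dot w (φ u) ≡ + 0
      w·φ≡0 u = begin
        dot w (φ u)                      ≡⟨ dot-shiftʳ w u k (dot w u) ⟩
        dot w u - dot w u * dot w k      ≡⟨ cong (λ z → dot w u - dot w u * z) w·k≡1 ⟩
        dot w u - dot w u * + 1          ≡⟨ cong (λ z → dot w u - z) (ℤP.*-identityʳ (dot w u)) ⟩
        dot w u - dot w u                ≡⟨ ℤP.+-inverseʳ (dot w u) ⟩
        + 0                              ∎

      φ-isometric : ∀ u v → bilin (Q+ww w) (φ u) (φ v) ≡ bilin Q u v
      φ-isometric u v = begin
        bilin (Q+ww w) (φ u) (φ v)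
          ≡⟨ rank-one-update w (φ u) (φ v) ⟩
        bilin Q (φ u) (φ v) + dot w (φ u) * dot w (φ v)
          ≡⟨ cong (λ z → bilin Q (φ u) (φ v) + z * dot w (φ v)) (w·φ≡0 u) ⟩
        bilin Q (φ u) (φ v) + + 0
          ≡⟨ ℤP.+-identityʳ (bilin Q (φ u) (φ v)) ⟩
        bilin Q (φ u) (φ v)
          ≡⟨ translation-along-radical k k-radical u v (dot w u) (dot w v) ⟩
        bilin Q u v
          ∎

  realizable : + 0 < a → + 0 < d₁ → + 0 ≤ Δ → Σ (ZLattice 3) λ N → Isometry Q (gram N)
  realizable 0<a 0<d₁ 0≤Δ = by-cases (Δ ≟ + 0)
    where
    by-cases : Dec (Δ ≡ + 0) → Σ (ZLattice 3) λ N → Isometry Q (gram N)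
    by-cases (yes Δ≡0) = realizable-degenerate 0<a 0<d₁ Δ≡0
    by-cases (no Δ≢0)  = realizable-nondegenerate 0<a 0<d₁ (ℤP.≤∧≢⇒< 0≤Δ (Δ≢0 ∘ sym))

  buried : (ℓ₁ ℓ₂ : ZLattice 2) → + 0 < a → + 0 < d₁ → + 4 * (s * s) ≤ a * a → a * a ≤ + 4 * d₁ * d₂ →
           Isometry (gram ℓ₁) (gram2 a b₁ c₁) → Isometry (gram ℓ₂) (gram2 a b₂ c₂) → BuriedInRank3 ℓ₁ ℓ₂
  buried ℓ₁ ℓ₂ 0<a 0<d₁ 4s²≤a² a²≤4d₁d₂ ι₁ ι₂ =
    let N , Q↪N = realizable 0<a 0<d₁ (sandwich⇒nonneg {a} {s} {d₁} {d₂} 4s²≤a² a²≤4d₁d₂)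
    in N , isometry⇒represents {ℓ = ℓ₁} {L = N} (isometry-trans ι₁ (isometry-trans embed₁₂ Q↪N))
         , isometry⇒represents {ℓ = ℓ₂} {L = N} (isometry-trans ι₂ (isometry-trans embed₁₃ Q↪N))

corollary3p11 : (ℓ₁ ℓ₂ : ZLattice 2) (a : ℤ) → + 0 < a
    → a * a ≤ + 4 * det2 ℓ₁ * det2 ℓ₂
    → PrimRepresents ℓ₁ a → PrimRepresents ℓ₂ a
    → BuriedInRank3 ℓ₁ ℓ₂
corollary3p11 ℓ₁ ℓ₂ a 0<a a²≤4det₁det₂ rep₁ rep₂ =
  let b₁ , c₁ , d₁≡det₁ , ι₁ = BinaryLattice.normal-form ℓ₁ a rep₁
      b₂ , c₂ , d₂≡det₂ , ι₂ = BinaryLattice.normal-form ℓ₂ a rep₂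
      t , 4s²≤a² = nearest-multiple 0<a (b₁ * b₂)
  in TernaryForm.buried a b₁ b₂ c₁ c₂ t ℓ₁ ℓ₂ 0<a (subst (+ 0 <_) (sym d₁≡det₁) (BinaryLattice.det2-pos ℓ₁))
       4s²≤a² (subst₂ (λ d₁ d₂ → a * a ≤ + 4 * d₁ * d₂) (sym d₁≡det₁) (sym d₂≡det₂) a²≤4det₁det₂) ι₁ ι₂
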